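{- Let $G$ be a chordal graph and $s,t\in V(G)$. Then there exist $\operatorname{dist}_G(s,t)-1$ pairwise vertex-disjoint cliques of $G$, each of which is an $s,t$-cut in $G$.
   Context: An $s,t$-cut is a set of vertices not containing $s$ or $t$ whose removal leaves no path between $s$ and $t$. -}

module Defs where

open import Data.Nat using (ℕ; zero; suc; _≤_; _∸_)
open import Data.Fin using (Fin; toℕ)
open import Data.Fin.Subset using (Subset; _∈_; _∉_)
open import Data.Product using (Σ; _×_; ∃; ∃-syntax)
open import Data.Sum using (_⊎_)
open import Relation.Nullary using (¬_; Dec)
open import Relation.Binary.PropositionalEquality using (_≡_; _≢_)
open import Function.Definitions using (Injective)

record Graph (n : ℕ) : Set₁ where
  field
    Adj    : Fin n → Fin n → Set
    sym    : ∀ {u v} → Adj u v → Adj v u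
    irrefl : ∀ {u} → ¬ Adj u u
    dec    : ∀ u v → Dec (Adj u v)
open Graph public

data Walk {n : ℕ} (G : Graph n) : Fin n → Fin n → ℕ → Set where
  [] : ∀ {u} → Walk G u u zero
  _∷_ : ∀ {u v w ℓ} → Adj G u v → Walk G v w ℓ → Walk G u w (suc ℓ)

Dist : ∀ {n} → Graph n → Fin n → Fin n → ℕ → Set
Dist G s t d = Walk G s t d × (∀ ℓ → Walk G s t ℓ → d ≤ ℓ)

data WalkAvoiding {n : ℕ} (G : Graph n) (S : Subset n) : Fin n → Fin n → Set where
  [] : ∀ {u} → u ∉ S → WalkAvoiding G S u u
  _∷_ : ∀ {u v w} → u ∉ S → Adj G u v → WalkAvoiding G S v w → WalkAvoiding G S u w

IsCut : ∀ {n} → Graph n → Fin n → Fin n → Subset n → Set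
IsCut G s t S = s ∉ S × t ∉ S × ¬ WalkAvoiding G S s t

IsClique : ∀ {n} → Graph n → Subset n → Set
IsClique G K = ∀ u v → u ∈ K → v ∈ K → u ≢ v → Adj G u v

Consec : ∀ {k} → Fin k → Fin k → Set
Consec {k} i j = (toℕ j ≡ suc (toℕ i)) ⊎ ((suc (toℕ i) ≡ k) × (toℕ j ≡ 0))

IsCycle : ∀ {n k} → Graph n → (Fin k → Fin n) → Set
IsCycle {k = k} G c = (3 ≤ k) × Injective _≡_ _≡_ c × (∀ i j → Consec i j → Adj G (c i) (c j))

HasChord : ∀ {n k} → Graph n → (Fin k → Fin n) → Set
HasChord G c = ∃[ i ] ∃[ j ] (Adj G (c i) (c j) × ¬ Consec i j × ¬ Consec j i)

Chordal : ∀ {n} → Graph n → Set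
Chordal {n} G = ∀ k (c : Fin k → Fin n) → 4 ≤ k → IsCycle G c → HasChord G c

module Submission where

-- For 0 ≤ m ≤ d − 2 let K_m be the set of vertices at distance exactly m + 1 from s that have a neighbour in
-- the component C_m of t in G − B(s, m + 1), where B(s, r) is the ball of radius r around s. The K_m lie in
-- distinct distance spheres, so they are pairwise disjoint. Each K_m separates s from t: traversed backwards
-- from t ∉ B(s, m + 1), a walk avoiding K_m never enters B(s, m + 1), so it cannot reach s. Each K_m is a
-- clique: two non-adjacent u, w ∈ K_m are joined by a path through C_m and by a path through B(s, m); there
-- are no edges between these two sets, so shortening both paths to induced ones gives a chordless cycle of
-- length at least 4.

open import Defs
open import Data.Nat using (ℕ; zero; suc; _∸_; _≤_; _<_; _+_; z≤n; s≤s)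
open import Data.Nat.Properties using (suc-injective; ≤-trans; n≤1+n; m≤n⇒m≤1+n; <⇒≤; <⇒≱; <-cmp)
open import Data.Fin using (Fin; zero; suc; toℕ; fromℕ; _≟_)
open import Data.Fin.Properties using (injective⇒≤; toℕ-fromℕ; toℕ-injective; toℕ<n; any?)
open import Data.Fin.Subset using (Subset; _∈_; _∉_)
open import Data.List using (List; []; _∷_; _++_; [_]; length; lookup)
open import Data.List.Membership.Propositional using () renaming (_∈_ to _∈ₗ_; _∉_ to _∉ₗ_)
open import Data.List.Membership.Propositional.Properties using (∈-++⁻; ∈-++⁺ˡ; ∈-++⁺ʳ; ∈-lookup)
open import Data.List.Relation.Unary.Any as Any using (Any; here; there)
open import Data.List.Relation.Unary.All as All using (All; []; _∷_)
import Data.List.Relation.Unary.All.Properties as All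
open import Data.List.Relation.Binary.Subset.Propositional using (_⊆_)
open import Data.List.Relation.Binary.Subset.Propositional.Properties using (⊆-trans; ∷⁺ʳ; xs⊆x∷xs)
open import Data.Product using (Σ; _×_; _,_; proj₁; proj₂)
open import Data.Sum as Sum using (_⊎_; inj₁; inj₂)
open import Data.Unit using (⊤; tt)
open import Data.Empty using (⊥; ⊥-elim)
open import Data.Bool.Properties using (T-≡)
import Data.Vec as Vec
open import Data.Vec.Properties using (lookup∘tabulate; []=⇒lookup; lookup⇒[]=)
open import Function using (id; _∘_)
open import Function.Bundles using (Equivalence; _⇔_; mk⇔)
open import Function.Definitions using (Injective)
open import Relation.Nullary using (¬_; Dec; yes; no)
open import Relation.Nullary.Decidable using (isYes; toWitness; fromWitness; _⊎-dec_; _×-dec_; ¬?)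
open import Relation.Binary.Definitions using (tri<; tri≈; tri>)
open import Relation.Binary.PropositionalEquality using (_≡_; _≢_; refl; cong; subst; trans) renaming (sym to ≡-sym)

module _ {n : ℕ} {P : Fin n → Set} (P? : ∀ v → Dec (P v)) where

  subsetOf : Subset n
  subsetOf = Vec.tabulate (isYes ∘ P?)

  ∈-subsetOf⁻ : ∀ {v} → v ∈ subsetOf → P v
  ∈-subsetOf⁻ {v} v∈ =
    toWitness (Equivalence.from T-≡ (trans (≡-sym (lookup∘tabulate (isYes ∘ P?) v)) ([]=⇒lookup v∈)))

  ∈-subsetOf⁺ : ∀ {v} → P v → v ∈ subsetOf
  ∈-subsetOf⁺ {v} pv =
    lookup⇒[]= v subsetOf (trans (lookup∘tabulate (isYes ∘ P?) v) (Equivalence.to T-≡ (fromWitness pv)))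

module Routes {n : ℕ} (G : Graph n) where

  data Route : Fin n → Fin n → Set where
    stop   : ∀ x → Route x x
    _∷⟨_⟩_ : ∀ x {y z} → Adj G x y → Route y z → Route x z

  infixr 5 _∷⟨_⟩_

  after : ∀ {a b} → Route a b → List (Fin n)
  after (stop _) = []
  after (_∷⟨_⟩_ _ {y} _ p) = y ∷ after p

  vertices : ∀ {a b} → Route a b → List (Fin n)
  vertices {a} p = a ∷ after p

  front : ∀ {a b} → Route a b → List (Fin n)
  front (stop _) = []
  front (x ∷⟨ _ ⟩ p) = x ∷ front p

  interior : ∀ {a b} → Route a b → List (Fin n)
  interior (stop _) = []
  interior (_ ∷⟨ _ ⟩ p) = front p

  vertices≡front++end : ∀ {a b} (p : Route a b) → vertices p ≡ front p ++ [ b ]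
  vertices≡front++end (stop _) = refl
  vertices≡front++end (x ∷⟨ _ ⟩ p) = cong (x ∷_) (vertices≡front++end p)

  front⊆vertices : ∀ {a b} (p : Route a b) → front p ⊆ vertices p
  front⊆vertices (_ ∷⟨ _ ⟩ _) (here refl) = here refl
  front⊆vertices (_ ∷⟨ _ ⟩ p) (there v∈) = there (front⊆vertices p v∈)

  end∈vertices : ∀ {a b} (p : Route a b) → b ∈ₗ vertices p
  end∈vertices (stop _) = here refl
  end∈vertices (_ ∷⟨ _ ⟩ p) = there (end∈vertices p)

  lookup-end : ∀ {a b} (p : Route a b) → lookup (vertices p) (fromℕ (length (after p))) ≡ b
  lookup-end (stop _) = refl
  lookup-end (_ ∷⟨ _ ⟩ p) = lookup-end p

  after-long : ∀ {a b} (p : Route a b) → a ≢ b → ¬ Adj G a b → 2 ≤ length (after p)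
  after-long (stop _) a≢b _ = ⊥-elim (a≢b refl)
  after-long (_ ∷⟨ e ⟩ stop _) _ a≁b = ⊥-elim (a≁b e)
  after-long (_ ∷⟨ _ ⟩ _ ∷⟨ _ ⟩ _) _ _ = s≤s (s≤s z≤n)

  edge : ∀ {x y} → Adj G x y → Route x y
  edge {x} {y} e = x ∷⟨ e ⟩ stop y

  infixr 5 _++ᴿ_
  _++ᴿ_ : ∀ {a b c} → Route a b → Route b c → Route a c
  stop _ ++ᴿ q = q
  (x ∷⟨ e ⟩ p) ++ᴿ q = x ∷⟨ e ⟩ (p ++ᴿ q)

  reverse : ∀ {a b} → Route a b → Route b a
  reverse (stop x) = stop x
  reverse (x ∷⟨ e ⟩ p) = reverse p ++ᴿ edge (sym G e)

  after-++ᴿ : ∀ {a b c} (p : Route a b) (q : Route b c) → after (p ++ᴿ q) ≡ after p ++ after q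
  after-++ᴿ (stop _) q = refl
  after-++ᴿ (_∷⟨_⟩_ _ {y} _ p) q = cong (y ∷_) (after-++ᴿ p q)

  vertices-++ᴿ : ∀ {a b c} (p : Route a b) (q : Route b c) → vertices (p ++ᴿ q) ≡ vertices p ++ after q
  vertices-++ᴿ {a} p q = cong (a ∷_) (after-++ᴿ p q)

  front-++ᴿ-edge : ∀ {a y b} (q : Route a y) (f : Adj G y b) → front (q ++ᴿ edge f) ≡ vertices q
  front-++ᴿ-edge (stop _) f = refl
  front-++ᴿ-edge (x ∷⟨ _ ⟩ q) f = cong (x ∷_) (front-++ᴿ-edge q f)

  interior-++ᴿ-edge : ∀ {a y b} (q : Route a y) (f : Adj G y b) → interior (q ++ᴿ edge f) ≡ after q
  interior-++ᴿ-edge (stop _) f = refl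
  interior-++ᴿ-edge (_ ∷⟨ _ ⟩ q) f = front-++ᴿ-edge q f

  All-++ᴿ : ∀ {P : Fin n → Set} {a b c} (p : Route a b) (q : Route b c) →
            All P (vertices p) → All P (vertices q) → All P (vertices (p ++ᴿ q))
  All-++ᴿ (stop _) q _ Pq = Pq
  All-++ᴿ (x ∷⟨ _ ⟩ p) q (Px ∷ Pp) Pq = Px ∷ All-++ᴿ p q Pp Pq

  All-reverse : ∀ {P : Fin n → Set} {a b} (p : Route a b) → All P (vertices p) → All P (vertices (reverse p))
  All-reverse (stop _) Pp = Pp
  All-reverse (x ∷⟨ _ ⟩ p) (Px ∷ Pp@(Py ∷ _)) =
    All-++ᴿ (reverse p) (edge _) (All-reverse p Pp) (Py ∷ Px ∷ [])

  data SnocView : ∀ {a b} → Route a b → Set where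
    stopᵛ : ∀ x → SnocView (stop x)
    _∷ʳᵛ_ : ∀ {a y b} (q : Route a y) (f : Adj G y b) → SnocView (q ++ᴿ edge f)

  snocView : ∀ {a b} (p : Route a b) → SnocView p
  snocView (stop x) = stopᵛ x
  snocView (x ∷⟨ e ⟩ p) with snocView p
  ... | stopᵛ _ = stop x ∷ʳᵛ e
  ... | q ∷ʳᵛ f = (x ∷⟨ e ⟩ q) ∷ʳᵛ f

  EndpointOr : Fin n → Fin n → (Fin n → Set) → Fin n → Set
  EndpointOr a b P v = v ≡ a ⊎ v ≡ b ⊎ P v

  EndpointOr-interior : ∀ {a b v} (P : Fin n → Set) → EndpointOr a b P v → v ≢ a → v ≢ b → P v
  EndpointOr-interior _ (inj₁ v≡a) v≢a _ = ⊥-elim (v≢a v≡a)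
  EndpointOr-interior _ (inj₂ (inj₁ v≡b)) _ v≢b = ⊥-elim (v≢b v≡b)
  EndpointOr-interior _ (inj₂ (inj₂ pv)) _ _ = pv

  detour : ∀ {a a′ c b′ b} → Adj G a a′ → Route a′ c → Route c b′ → Adj G b′ b → Route a b
  detour {a} e p q f = a ∷⟨ e ⟩ (p ++ᴿ q ++ᴿ edge f)

  All-detour : ∀ {P : Fin n → Set} {a a′ c b′ b}
               (e : Adj G a a′) (p : Route a′ c) (q : Route c b′) (f : Adj G b′ b) →
               All P (vertices p) → All P (vertices q) → All (EndpointOr a b P) (vertices (detour e p q f))
  All-detour e p q f Pp Pq =
    inj₁ refl ∷ All-++ᴿ p (q ++ᴿ edge f) (All.map (inj₂ ∘ inj₂) Pp)
                  (All-++ᴿ q (edge f) (All.map (inj₂ ∘ inj₂) Pq)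
                     (inj₂ (inj₂ (All.lookup Pq (end∈vertices q))) ∷ inj₂ (inj₁ refl) ∷ []))

module InducedRoutes {n : ℕ} (G : Graph n) where
  open Routes G

  AdjacentOnlyToHead : Fin n → List (Fin n) → Set
  AdjacentOnlyToHead x [] = ⊤
  AdjacentOnlyToHead x (y ∷ ys) = Adj G x y × All (¬_ ∘ Adj G x) ys

  IsInduced : List (Fin n) → Set
  IsInduced [] = ⊤
  IsInduced (x ∷ ys) = x ∉ₗ ys × AdjacentOnlyToHead x ys × IsInduced ys

  IsInduced-lookup-injective : ∀ xs → IsInduced xs → ∀ i j → lookup xs i ≡ lookup xs j → i ≡ j
  IsInduced-lookup-injective (x ∷ xs) _ zero zero _ = refl
  IsInduced-lookup-injective (x ∷ xs) (x∉ , _) zero (suc j) eq =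
    ⊥-elim (x∉ (subst (_∈ₗ xs) (≡-sym eq) (∈-lookup j)))
  IsInduced-lookup-injective (x ∷ xs) (x∉ , _) (suc i) zero eq =
    ⊥-elim (x∉ (subst (_∈ₗ xs) eq (∈-lookup i)))
  IsInduced-lookup-injective (x ∷ xs) (_ , _ , ind) (suc i) (suc j) eq =
    cong suc (IsInduced-lookup-injective xs ind i j eq)

  IsInduced-length≤ : ∀ xs → IsInduced xs → length xs ≤ n
  IsInduced-length≤ xs ind = injective⇒≤ (λ {i} {j} → IsInduced-lookup-injective xs ind i j)

  IsInduced-successive⇒adjacent : ∀ xs → IsInduced xs → ∀ i j → toℕ j ≡ suc (toℕ i) →
                                  Adj G (lookup xs i) (lookup xs j)
  IsInduced-successive⇒adjacent (x ∷ y ∷ xs) (_ , (e , _) , _) zero (suc zero) _ = e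
  IsInduced-successive⇒adjacent (x ∷ xs) (_ , _ , ind) (suc i) (suc j) eq =
    IsInduced-successive⇒adjacent xs ind i j (suc-injective eq)

  AdjacentOnlyToHead⇒zero : ∀ x xs → AdjacentOnlyToHead x xs → ∀ j → Adj G x (lookup xs j) → toℕ j ≡ 0
  AdjacentOnlyToHead⇒zero x (y ∷ xs) _ zero _ = refl
  AdjacentOnlyToHead⇒zero x (y ∷ xs) (_ , far) (suc j) e = ⊥-elim (All.lookup far (∈-lookup j) e)

  IsInduced-adjacent⇒successive : ∀ xs → IsInduced xs → ∀ i j → Adj G (lookup xs i) (lookup xs j) →
                                  toℕ j ≡ suc (toℕ i) ⊎ toℕ i ≡ suc (toℕ j)
  IsInduced-adjacent⇒successive (x ∷ xs) _ zero zero e = ⊥-elim (irrefl G e)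
  IsInduced-adjacent⇒successive (x ∷ xs) (_ , only , _) zero (suc j) e =
    inj₁ (cong suc (AdjacentOnlyToHead⇒zero x xs only j e))
  IsInduced-adjacent⇒successive (x ∷ xs) (_ , only , _) (suc i) zero e =
    inj₂ (cong suc (AdjacentOnlyToHead⇒zero x xs only i (sym G e)))
  IsInduced-adjacent⇒successive (x ∷ xs) (_ , _ , ind) (suc i) (suc j) e =
    Sum.map (cong suc) (cong suc) (IsInduced-adjacent⇒successive xs ind i j e)

  IsInduced-++⁻ˡ : ∀ xs {ys} → IsInduced (xs ++ ys) → IsInduced xs
  IsInduced-++⁻ˡ [] _ = tt
  IsInduced-++⁻ˡ (x ∷ []) _ = (λ ()) , tt , tt
  IsInduced-++⁻ˡ (x ∷ y ∷ xs) (x∉ , (e , far) , ind) =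
    (λ x∈ → x∉ (∈-++⁺ˡ x∈)) , (e , All.++⁻ˡ xs far) , IsInduced-++⁻ˡ (y ∷ xs) ind

  IsInduced-++-disjoint : ∀ xs {ys} → IsInduced (xs ++ ys) → ∀ {v} → v ∈ₗ xs → v ∉ₗ ys
  IsInduced-++-disjoint (x ∷ xs) (x∉ , _) (here refl) x∈ = x∉ (∈-++⁺ʳ xs x∈)
  IsInduced-++-disjoint (x ∷ xs) (_ , _ , ind) (there v∈) = IsInduced-++-disjoint xs ind v∈

  InducedRouteWithin : List (Fin n) → Fin n → Fin n → Set
  InducedRouteWithin S a b = Σ (Route a b) (λ r → IsInduced (vertices r) × vertices r ⊆ S)

  AdjOrEq : Fin n → Fin n → Set
  AdjOrEq x v = x ≡ v ⊎ Adj G x v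

  AdjOrEq? : ∀ x v → Dec (AdjOrEq x v)
  AdjOrEq? x v = (x ≟ v) ⊎-dec dec G x v

  prependAtHead : ∀ x {y z} (q : Route y z) → IsInduced (vertices q) →
                  ¬ Any (AdjOrEq x) (after q) → AdjOrEq x y → InducedRouteWithin (x ∷ vertices q) x z
  prependAtHead x q indq far (inj₁ refl) = q , indq , there
  prependAtHead x q indq far (inj₂ e) = x ∷⟨ e ⟩ q , (x∉ , (e , nonadjacent) , indq) , id
    where
      x∉ : x ∉ₗ vertices q
      x∉ (here refl) = irrefl G e
      x∉ (there x∈) = far (Any.map inj₁ x∈)
      nonadjacent : All (¬_ ∘ Adj G x) (after q)
      nonadjacent = All.map (λ ¬near e → ¬near (inj₂ e)) (All.¬Any⇒All¬ (after q) far)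

  -- Jump from x straight to the last vertex of q that x meets.
  prependInduced : ∀ x {y z} (q : Route y z) → IsInduced (vertices q) →
                   Any (AdjOrEq x) (vertices q) → InducedRouteWithin (x ∷ vertices q) x z
  prependInduced x q indq hit with Any.any? (AdjOrEq? x) (after q)
  ... | no far = prependAtHead x q indq far (Any.head far hit)
  prependInduced x (stop _) _ _ | yes ()
  prependInduced x (y ∷⟨ _ ⟩ q) (_ , _ , indq) _ | yes later =
    let r , indr , r⊆ = prependInduced x q indq later
    in r , indr , ⊆-trans r⊆ (∷⁺ʳ x (xs⊆x∷xs _ y))

  inducedSubroute : ∀ {a b} (p : Route a b) → InducedRouteWithin (vertices p) a b
  inducedSubroute (stop x) = stop x , ((λ ()) , tt , tt) , id
  inducedSubroute (x ∷⟨ e ⟩ p) =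
    let q , indq , q⊆p = inducedSubroute p
        r , indr , r⊆ = prependInduced x q indq (here (inj₂ e))
    in r , indr , ⊆-trans r⊆ (∷⁺ʳ x q⊆p)

  IsInduced-++ᴿ : ∀ {a b c} (p : Route a b) (q : Route b c) → IsInduced (vertices p) → IsInduced (vertices q) →
                  (∀ {x z} → x ∈ₗ front p → z ∈ₗ after q → x ≢ z × ¬ Adj G x z) →
                  IsInduced (vertices (p ++ᴿ q))
  IsInduced-++ᴿ (stop _) q _ indq _ = indq
  IsInduced-++ᴿ (x ∷⟨ e ⟩ p) q (x∉p , (_ , far) , indp) indq apart =
    x∉ , (e , farq) , IsInduced-++ᴿ p q indp indq (λ x∈ → apart (there x∈))
    where
      x∉ : x ∉ₗ vertices (p ++ᴿ q)
      x∉ x∈ with ∈-++⁻ (vertices p) (subst (x ∈ₗ_) (vertices-++ᴿ p q) x∈)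
      ... | inj₁ x∈p = x∉p x∈p
      ... | inj₂ x∈q = proj₁ (apart (here refl) x∈q) refl
      farq : All (¬_ ∘ Adj G x) (after (p ++ᴿ q))
      farq = subst (All _) (≡-sym (after-++ᴿ p q))
                   (All.++⁺ far (All.tabulate (λ z∈ → proj₂ (apart (here refl) z∈))))

  IsInduced-penultimate : ∀ {a y b} (q : Route a y) (f : Adj G y b) → IsInduced (vertices (q ++ᴿ edge f)) →
                          ∀ {v} → v ∈ₗ vertices q → Adj G v b → v ≡ y
  IsInduced-penultimate (stop _) f _ (here refl) _ = refl
  IsInduced-penultimate {b = b} (x ∷⟨ e ⟩ q) f (_ , (_ , far) , _) (here refl) xb =
    ⊥-elim (All.lookup far (subst (b ∈ₗ_) (≡-sym (after-++ᴿ q (edge f))) (∈-++⁺ʳ (after q) (here refl))) xb)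
  IsInduced-penultimate (x ∷⟨ e ⟩ q) f (_ , _ , ind) (there v∈) vb = IsInduced-penultimate q f ind v∈ vb

  All-interior : ∀ {a b} (P : Fin n → Set) (p : Route a b) → IsInduced (vertices p) →
                 All (EndpointOr a b P) (vertices p) → All P (interior p)
  All-interior P (stop _) _ _ = []
  All-interior P (_ ∷⟨ _ ⟩ p) (a∉p , _ , indp) (_ ∷ Pp) = All.tabulate λ v∈ →
    EndpointOr-interior P (All.lookup Pp (front⊆vertices p v∈))
      (λ { refl → a∉p (front⊆vertices p v∈) })
      (λ { refl → IsInduced-++-disjoint (front p) (subst IsInduced (vertices≡front++end p) indp) v∈ (here refl) })

  InducedRouteThrough : (Fin n → Set) → Fin n → Fin n → Set
  InducedRouteThrough P a b = Σ (Route a b) (λ r → IsInduced (vertices r) × All (EndpointOr a b P) (vertices r))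

  inducedDetour : ∀ {P : Fin n → Set} {a a′ c b′ b} → Adj G a a′ → (p : Route a′ c) → All P (vertices p) →
                  (q : Route c b′) → All P (vertices q) → Adj G b′ b → InducedRouteThrough P a b
  inducedDetour e p Pp q Pq f =
    let r , indr , r⊆ = inducedSubroute (detour e p q f)
    in r , indr , All.anti-mono r⊆ (All-detour e p q f Pp Pq)

module ChordlessCycles {n : ℕ} {G : Graph n} (chordal : Chordal G) where
  open Routes G
  open InducedRoutes G

  module Closure {u a b : Fin n} (R : Route a b) (indR : IsInduced (vertices R)) (u∉R : u ∉ₗ vertices R)
                 (ua : Adj G u a) (ub : Adj G u b)
                 (onlyEnds : ∀ {v} → v ∈ₗ vertices R → Adj G u v → v ≡ a ⊎ v ≡ b) where

    k : ℕ
    k = suc (length (vertices R))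

    cycle : Fin k → Fin n
    cycle = lookup (u ∷ vertices R)

    lookup-injective : ∀ i j → lookup (vertices R) i ≡ lookup (vertices R) j → i ≡ j
    lookup-injective = IsInduced-lookup-injective (vertices R) indR

    lookup≡end⇔ : ∀ i → lookup (vertices R) i ≡ b ⇔ toℕ i ≡ length (after R)
    lookup≡end⇔ i = mk⇔
      (λ eq → trans (cong toℕ (lookup-injective i _ (trans eq (≡-sym (lookup-end R))))) (toℕ-fromℕ _))
      (λ eq → trans (cong (lookup (vertices R)) (toℕ-injective (trans eq (≡-sym (toℕ-fromℕ _))))) (lookup-end R))

    cycle-injective : Injective _≡_ _≡_ cycle
    cycle-injective {zero} {zero} _ = refl
    cycle-injective {zero} {suc j} eq = ⊥-elim (u∉R (subst (_∈ₗ vertices R) (≡-sym eq) (∈-lookup j)))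
    cycle-injective {suc i} {zero} eq = ⊥-elim (u∉R (subst (_∈ₗ vertices R) eq (∈-lookup i)))
    cycle-injective {suc i} {suc j} eq = cong suc (lookup-injective i j eq)

    cycle-adjacent : ∀ i j → Consec i j → Adj G (cycle i) (cycle j)
    cycle-adjacent zero (suc zero) _ = ua
    cycle-adjacent zero zero (inj₁ ())
    cycle-adjacent zero zero (inj₂ (() , _))
    cycle-adjacent zero (suc (suc _)) (inj₁ ())
    cycle-adjacent zero (suc (suc _)) (inj₂ (() , _))
    cycle-adjacent (suc i) (suc j) (inj₁ eq) =
      IsInduced-successive⇒adjacent (vertices R) indR i j (suc-injective eq)
    cycle-adjacent (suc i) zero (inj₂ (eq , _)) =
      subst (λ v → Adj G v u) (≡-sym (Equivalence.from (lookup≡end⇔ i) (suc-injective (suc-injective eq))))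
            (sym G ub)

    adjacent-to-apex : ∀ j → Adj G u (lookup (vertices R) j) → Consec {k} zero (suc j) ⊎ Consec {k} (suc j) zero
    adjacent-to-apex j e with onlyEnds (∈-lookup j) e
    ... | inj₁ isStart = inj₁ (inj₁ (cong (suc ∘ toℕ) (lookup-injective j zero isStart)))
    ... | inj₂ isEnd = inj₂ (inj₂ (cong (2 +_) (Equivalence.to (lookup≡end⇔ j) isEnd) , refl))

    cycle-chordless : ∀ i j → Adj G (cycle i) (cycle j) → Consec i j ⊎ Consec j i
    cycle-chordless zero zero e = ⊥-elim (irrefl G e)
    cycle-chordless zero (suc j) e = adjacent-to-apex j e
    cycle-chordless (suc i) zero e = Sum.swap (adjacent-to-apex i (sym G e))
    cycle-chordless (suc i) (suc j) e =
      Sum.map (inj₁ ∘ cong suc) (inj₁ ∘ cong suc) (IsInduced-adjacent⇒successive (vertices R) indR i j e)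

  -- u followed by R is a chordless cycle of length at least 4.
  no-chordless-closure : ∀ {u a b} (R : Route a b) → IsInduced (vertices R) → a ≢ b → ¬ Adj G a b →
                         u ∉ₗ vertices R → Adj G u a → Adj G u b →
                         (∀ {v} → v ∈ₗ vertices R → Adj G u v → v ≡ a ⊎ v ≡ b) → ⊥
  no-chordless-closure R indR a≢b a≁b u∉R ua ub onlyEnds =
    let i , j , e , ¬ij , ¬ji = chordal k cycle (s≤s (s≤s long)) (3≤k , cycle-injective , cycle-adjacent)
    in Sum.[ ¬ij , ¬ji ] (cycle-chordless i j e)
    where
      open Closure R indR u∉R ua ub onlyEnds
      long : 2 ≤ length (after R)
      long = after-long R a≢b a≁b
      3≤k : 3 ≤ k
      3≤k = ≤-trans (n≤1+n 3) (s≤s (s≤s long))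

  module _ {X A : Fin n → Set} (X∩A : ∀ {v} → X v → ¬ A v) (X≁A : ∀ {x y} → X x → A y → ¬ Adj G x y) where

    -- As X and A are disjoint and non-adjacent, P without u followed by Q without its last edge is induced,
    -- and u is adjacent exactly to its two ends.
    no-hole : ∀ {u w} → InducedRouteThrough X u w → InducedRouteThrough A w u → u ≢ w → ¬ Adj G u w → ⊥
    no-hole (stop _ , _) _ u≢w _ = u≢w refl
    no-hole {u} (_∷⟨_⟩_ u {p₁} e P₁ , indP , XP) (Q , indQ , AQ) u≢w u≁w with snocView Q
    ... | stopᵛ _ = u≢w refl
    ... | _∷ʳᵛ_ {y = y} Q₀ f =
      no-chordless-closure (P₁ ++ᴿ Q₀) indR (λ { refl → X∩A Xp₁ Ay }) (X≁A Xp₁ Ay) u∉R e (sym G f) onlyEnds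
      where
        u∉P₁ : u ∉ₗ vertices P₁
        u∉P₁ = proj₁ indP
        indQ₀+u : IsInduced (vertices Q₀ ++ [ u ])
        indQ₀+u = subst IsInduced (vertices-++ᴿ Q₀ (edge f)) indQ
        u∉Q₀ : u ∉ₗ vertices Q₀
        u∉Q₀ u∈ = IsInduced-++-disjoint (vertices Q₀) indQ₀+u u∈ (here refl)
        X-interior : All X (front P₁)
        X-interior = All-interior X (u ∷⟨ e ⟩ P₁) indP XP
        A-interior : All A (after Q₀)
        A-interior = subst (All A) (interior-++ᴿ-edge Q₀ f) (All-interior A (Q₀ ++ᴿ edge f) indQ AQ)
        Xp₁ : X p₁
        Xp₁ = EndpointOr-interior X (All.lookup XP (there (here refl)))
                (λ { refl → u∉P₁ (here refl) }) (λ { refl → u≁w e })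
        Ay : A y
        Ay = EndpointOr-interior A (All.lookup AQ (subst (y ∈ₗ_) (≡-sym (vertices-++ᴿ Q₀ (edge f)))
                                                      (∈-++⁺ˡ (end∈vertices Q₀))))
               (λ { refl → u≁w (sym G f) }) (λ { refl → irrefl G f })
        indR : IsInduced (vertices (P₁ ++ᴿ Q₀))
        indR = IsInduced-++ᴿ P₁ Q₀ (proj₂ (proj₂ indP)) (IsInduced-++⁻ˡ (vertices Q₀) indQ₀+u) λ x∈ z∈ →
                 let Xx = All.lookup X-interior x∈ ; Az = All.lookup A-interior z∈
                 in (λ { refl → X∩A Xx Az }) , X≁A Xx Az
        u∉R : u ∉ₗ vertices (P₁ ++ᴿ Q₀)
        u∉R u∈ with ∈-++⁻ (vertices P₁) (subst (u ∈ₗ_) (vertices-++ᴿ P₁ Q₀) u∈)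
        ... | inj₁ u∈P₁ = u∉P₁ u∈P₁
        ... | inj₂ u∈Q₀ = u∉Q₀ (there u∈Q₀)
        onlyEnds : ∀ {v} → v ∈ₗ vertices (P₁ ++ᴿ Q₀) → Adj G u v → v ≡ p₁ ⊎ v ≡ y
        onlyEnds {v} v∈ uv with ∈-++⁻ (vertices P₁) (subst (v ∈ₗ_) (vertices-++ᴿ P₁ Q₀) v∈)
        ... | inj₁ (here refl) = inj₁ refl
        ... | inj₁ (there v∈P₁) = ⊥-elim (All.lookup (proj₂ (proj₁ (proj₂ indP))) v∈P₁ uv)
        ... | inj₂ v∈Q₀ = inj₂ (IsInduced-penultimate Q₀ f indQ (there v∈Q₀) (sym G uv))

module Balls {n : ℕ} (G : Graph n) where
  open Routes G

  Ball : ℕ → Fin n → Fin n → Set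
  Ball zero a v = a ≡ v
  Ball (suc r) a v = Ball r a v ⊎ Σ (Fin n) (λ y → Ball r a y × Adj G y v)

  Ball? : ∀ r a v → Dec (Ball r a v)
  Ball? zero a v = a ≟ v
  Ball? (suc r) a v = Ball? r a v ⊎-dec any? (λ y → Ball? r a y ×-dec dec G y v)

  Ball-center : ∀ r a → Ball r a a
  Ball-center zero a = refl
  Ball-center (suc r) a = inj₁ (Ball-center r a)

  Ball-mono : ∀ {r r′ a v} → r ≤ r′ → Ball r a v → Ball r′ a v
  Ball-mono z≤n refl = Ball-center _ _
  Ball-mono (s≤s r≤r′) (inj₁ av) = inj₁ (Ball-mono r≤r′ av)
  Ball-mono (s≤s r≤r′) (inj₂ (y , ay , yv)) = inj₂ (y , Ball-mono r≤r′ ay , yv)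

  Walk-snoc : ∀ {a y v ℓ} → Walk G a y ℓ → Adj G y v → Walk G a v (suc ℓ)
  Walk-snoc [] e = e ∷ []
  Walk-snoc (e′ ∷ w) e = e′ ∷ Walk-snoc w e

  Ball⇒Walk : ∀ r {a v} → Ball r a v → Σ ℕ (λ ℓ → ℓ ≤ r × Walk G a v ℓ)
  Ball⇒Walk zero refl = 0 , z≤n , []
  Ball⇒Walk (suc r) (inj₁ av) =
    let ℓ , ℓ≤r , w = Ball⇒Walk r av in ℓ , m≤n⇒m≤1+n ℓ≤r , w
  Ball⇒Walk (suc r) (inj₂ (y , ay , yv)) =
    let ℓ , ℓ≤r , w = Ball⇒Walk r ay in suc ℓ , s≤s ℓ≤r , Walk-snoc w yv

  Dist⇒¬Ball : ∀ {a b d r} → Dist G a b d → r < d → ¬ Ball r a b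
  Dist⇒¬Ball {r = r} (_ , shortest) r<d ab =
    let ℓ , ℓ≤r , w = Ball⇒Walk r ab in <⇒≱ r<d (≤-trans (shortest ℓ w) ℓ≤r)

  Ball⇒Route : ∀ r {a v} → Ball r a v → Σ (Route a v) (λ p → All (Ball r a) (vertices p))
  Ball⇒Route zero refl = stop _ , refl ∷ []
  Ball⇒Route (suc r) (inj₁ av) =
    let p , Bp = Ball⇒Route r av in p , All.map inj₁ Bp
  Ball⇒Route (suc r) (inj₂ (y , ay , yv)) =
    let p , Bp = Ball⇒Route r ay
    in p ++ᴿ edge yv , All-++ᴿ p (edge yv) (All.map inj₁ Bp) (inj₁ ay ∷ inj₂ (y , ay , yv) ∷ [])

module Reachability {n : ℕ} (G : Graph n) {X : Fin n → Set} (X? : ∀ v → Dec (X v)) (t : Fin n) where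
  open Routes G
  open InducedRoutes G

  -- Reaching t inside X by a route of at most k edges; the bound k keeps this decidable.
  ReachesIn : ℕ → Fin n → Set
  ReachesIn zero v = v ≡ t × X v
  ReachesIn (suc k) v = ReachesIn k v ⊎ (X v × Σ (Fin n) (λ y → Adj G v y × ReachesIn k y))

  ReachesIn? : ∀ k v → Dec (ReachesIn k v)
  ReachesIn? zero v = (v ≟ t) ×-dec X? v
  ReachesIn? (suc k) v = ReachesIn? k v ⊎-dec (X? v ×-dec any? (λ y → dec G v y ×-dec ReachesIn? k y))

  ReachesIn⇒X : ∀ k {v} → ReachesIn k v → X v
  ReachesIn⇒X zero (_ , xv) = xv
  ReachesIn⇒X (suc k) (inj₁ h) = ReachesIn⇒X k h
  ReachesIn⇒X (suc k) (inj₂ (xv , _)) = xv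

  ReachesIn-target : X t → ∀ k → ReachesIn k t
  ReachesIn-target xt zero = refl , xt
  ReachesIn-target xt (suc k) = inj₁ (ReachesIn-target xt k)

  ReachesIn⇒Route : ∀ k {v} → ReachesIn k v → Σ (Route v t) (λ p → All X (vertices p))
  ReachesIn⇒Route zero (refl , xt) = stop t , xt ∷ []
  ReachesIn⇒Route (suc k) (inj₁ h) = ReachesIn⇒Route k h
  ReachesIn⇒Route (suc k) (inj₂ (xv , _ , e , h)) =
    let p , Xp = ReachesIn⇒Route k h in _ ∷⟨ e ⟩ p , xv ∷ Xp

  Route⇒ReachesIn : ∀ k {v} (p : Route v t) → All X (vertices p) → length (after p) ≤ k → ReachesIn k v
  Route⇒ReachesIn k (stop _) (xt ∷ []) _ = ReachesIn-target xt k
  Route⇒ReachesIn (suc k) (_ ∷⟨ e ⟩ p) (xv ∷ Xp) (s≤s p≤k) =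
    inj₂ (xv , _ , e , Route⇒ReachesIn k p Xp p≤k)

  -- Induced routes have fewer than n edges, so the bound n loses no route.
  ReachesIn-step : ∀ {a b} → X a → Adj G a b → ReachesIn n b → ReachesIn n a
  ReachesIn-step {a} xa e h =
    let p , Xp = ReachesIn⇒Route n h
        r , indr , r⊆ = inducedSubroute (a ∷⟨ e ⟩ p)
    in Route⇒ReachesIn n r (All.anti-mono r⊆ (xa ∷ Xp)) (<⇒≤ (IsInduced-length≤ (vertices r) indr))

module Layers {n : ℕ} (G : Graph n) (s t : Fin n) where
  open Routes G
  open InducedRoutes G
  open Balls G

  module Component (m : ℕ) = Reachability G (λ v → ¬? (Ball? (suc m) s v)) t

  -- The paper's K_m: the vertices at distance exactly m + 1 from s with a neighbour in the component of t in
  -- G − Ball (m + 1) s, which is Component.ReachesIn m n.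
  Layer : ℕ → Fin n → Set
  Layer m v = Ball (suc m) s v × ¬ Ball m s v × Σ (Fin n) (λ c → Adj G v c × Component.ReachesIn m n c)

  Layer? : ∀ m v → Dec (Layer m v)
  Layer? m v =
    Ball? (suc m) s v ×-dec ¬? (Ball? m s v) ×-dec any? (λ c → dec G v c ×-dec Component.ReachesIn? m n c)

  layer : ℕ → Subset n
  layer m = subsetOf (Layer? m)

  layer-disjoint : ∀ {m m′ v} → v ∈ layer m → v ∈ layer m′ → m ≡ m′
  layer-disjoint {m} {m′} v∈ v∈′ with ∈-subsetOf⁻ (Layer? m) v∈ | ∈-subsetOf⁻ (Layer? m′) v∈′ | <-cmp m m′
  ... | inBall , _ , _ | _ , outBall′ , _ | tri< m<m′ _ _ = ⊥-elim (outBall′ (Ball-mono m<m′ inBall))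
  ... | _ | _ | tri≈ _ m≡m′ _ = m≡m′
  ... | _ , outBall , _ | inBall′ , _ , _ | tri> _ _ m′<m = ⊥-elim (outBall (Ball-mono m′<m inBall′))

  Layer-adjacent : Chordal G → ∀ {m u w} → Layer m u → Layer m w → u ≢ w → Adj G u w
  Layer-adjacent _ (inj₁ u∈ , u∉ , _) _ _ = ⊥-elim (u∉ u∈)
  Layer-adjacent _ _ (inj₁ w∈ , w∉ , _) _ = ⊥-elim (w∉ w∈)
  Layer-adjacent chordal {m} {u} {w} (inj₂ (yu , yu∈ , yu~u) , _ , cu , u~cu , cu∈)
                                     (inj₂ (yw , yw∈ , yw~w) , _ , cw , w~cw , cw∈) u≢w with dec G u w
  ... | yes u~w = u~w
  ... | no u≁w =
    let pu , Xpu = ReachesIn⇒Route n cu∈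
        pw , Xpw = ReachesIn⇒Route n cw∈
        qu , Bqu = Ball⇒Route m yu∈
        qw , Bqw = Ball⇒Route m yw∈
    in ⊥-elim (no-hole chordal (λ beyond inner → beyond (inj₁ inner))
                 (λ {x} {y} beyond inner x~y → beyond (inj₂ (y , inner , sym G x~y)))
                 (inducedDetour u~cu pu Xpu (reverse pw) (All-reverse pw Xpw) (sym G w~cw))
                 (inducedDetour (sym G yw~w) (reverse qw) (All-reverse qw Bqw) qu Bqu yu~u) u≢w u≁w)
    where
      open Component m
      open ChordlessCycles

  layer-clique : Chordal G → ∀ m → IsClique G (layer m)
  layer-clique chordal m u w u∈ w∈ =
    Layer-adjacent chordal (∈-subsetOf⁻ (Layer? m) u∈) (∈-subsetOf⁻ (Layer? m) w∈)

  layer-cut : ∀ {m} → ¬ Ball (suc m) s t → IsCut G s t (layer m)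
  layer-cut {m} t∉B = s∉K , t∉K , λ walk → ReachesIn⇒X n (component walk) (Ball-center (suc m) s)
    where
      open Component m
      s∉K : s ∉ layer m
      s∉K s∈ = proj₁ (proj₂ (∈-subsetOf⁻ (Layer? m) s∈)) (Ball-center m s)
      t∉K : t ∉ layer m
      t∉K t∈ = t∉B (proj₁ (∈-subsetOf⁻ (Layer? m) t∈))
      component : ∀ {a} → WalkAvoiding G (layer m) a t → ReachesIn n a
      component ([] _) = ReachesIn-target t∉B n
      component {a} (_∷_ {v = b} a∉K a~b walk) = ReachesIn-step beyond a~b b∈C
        where
          b∈C : ReachesIn n b
          b∈C = component walk
          -- b lies outside Ball (m + 1) s, so a ∈ Ball (m + 1) s would put a in the layer.
          beyond : ¬ Ball (suc m) s a
          beyond a∈ = a∉K (∈-subsetOf⁺ (Layer? m)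
            (a∈ , (λ a∈′ → ReachesIn⇒X n b∈C (inj₂ (a , a∈′ , a~b))) , b , a~b , b∈C))

suc-toℕ<pred : ∀ d (i : Fin (d ∸ 1)) → suc (toℕ i) < d
suc-toℕ<pred (suc (suc d)) i = s≤s (toℕ<n i)

lemma11 : ∀ {n} (G : Graph n) → Chordal G → (s t : Fin n) (d : ℕ) → Dist G s t d →
          Σ (Fin (d ∸ 1) → Subset n) (λ K →
            (∀ i → IsClique G (K i) × IsCut G s t (K i)) ×
            (∀ i j v → v ∈ K i → v ∈ K j → i ≡ j))
lemma11 G chordal s t d dist =
  (λ i → layer (toℕ i)) ,
  (λ i → layer-clique chordal (toℕ i) , layer-cut (Balls.Dist⇒¬Ball G dist (suc-toℕ<pred d i))) ,
  (λ i j v v∈i v∈j → toℕ-injective (layer-disjoint v∈i v∈j))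
  where open Layers G s t
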